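{- Let $\Gamma_1,\Gamma_2$ be finite abelian groups with $|\Gamma_1|=2a+1$ and $|\Gamma_2|=2b+1$. Suppose that $2a+1$ divides $2b+1$ and that there exists a $\mathrm{M}^0_{\Gamma_2^*}(2,b)$. Then there exists a $\mathrm{M}^0_{\Gamma^*}(2,a+b+2ab)$, where $\Gamma=\Gamma_1\oplus\Gamma_2$.
   Context: For an abelian group $\Gamma$, $\Gamma^*=\Gamma\setminus\{0_\Gamma\}$. Given a subset $\Omega$ of an abelian group $\Gamma$, a $\mathrm{M}^0_\Omega(2,n)$ is a $2\times n$ array with no empty cells and entries in $\Omega$ in which every element of $\Omega$ appears exactly once and the entries of each row and of each column sum to $0\in\Gamma$. -}

module Defs where

open import Level using (Level)
open import Algebra.Bundles using (AbelianGroup; Monoid)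
import Algebra.Definitions.RawMonoid as RawMonoidDefs
open import Data.Nat using (ℕ)
open import Data.Fin using (Fin)
open import Data.Product using (Σ; _×_; ∃₂)
open import Relation.Nullary using (¬_)
open import Relation.Binary.PropositionalEquality using (_≡_)
import Relation.Binary.PropositionalEquality as ≡
open import Function.Bundles using (Bijection)

private
  variable
    c ℓ : Level

HasOrder : AbelianGroup c ℓ → ℕ → Set _
HasOrder G n = Bijection (≡.setoid (Fin n)) (AbelianGroup.setoid G)

gsum : (G : AbelianGroup c ℓ) → ∀ {n} → (Fin n → AbelianGroup.Carrier G) → AbelianGroup.Carrier G
gsum G = RawMonoidDefs.sum (Monoid.rawMonoid (AbelianGroup.monoid G))

-- A M^0_{Γ*}(2,n): a 2 × n array (no empty cells) with entries in Γ,
-- whose entries are exactly the nonzero elements of Γ, each appearing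
-- exactly once, and each row and column summing to 0.
record IsM0Star (G : AbelianGroup c ℓ) (n : ℕ)
                (A : Fin 2 → Fin n → AbelianGroup.Carrier G) : Set (c Level.⊔ ℓ) where
  open AbelianGroup G
  field
    entries-nonzero : ∀ i j → ¬ (A i j ≈ ε)
    entries-distinct : ∀ i j i′ j′ → A i j ≈ A i′ j′ → (i ≡ i′) × (j ≡ j′)
    covers-nonzero : ∀ (g : Carrier) → ¬ (g ≈ ε) → ∃₂ λ i j → A i j ≈ g
    row-sums : ∀ i → gsum G (A i) ≈ ε
    column-sums : ∀ j → gsum G (λ i → A i j) ≈ ε

M0Star : AbelianGroup c ℓ → ℕ → Set (c Level.⊔ ℓ)
M0Star G n = Σ (Fin 2 → Fin n → AbelianGroup.Carrier G) (IsM0Star G n)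

{-# OPTIONS --safe #-}
-- A M⁰_{Γ*}(2,n) is the same thing as a half-set of Γ* (one element out of
-- every pair {g, -g} of nonzero elements) of size n summing to 0: take it as
-- the first row and its negation as the second.  In a group of odd order 2a+1
-- only 0 is its own negative, so there is a half-set h of size a.  In Γ₁ ⊕ Γ₂
-- the elements (h k, y), y ∈ Γ₂, together with (0, x) for x in the first row
-- of the given M⁰_{Γ₂*}(2,b), form a half-set of size a(2b+1) + b.  Its
-- Γ₂-part sums to a · Σ Γ₂ + 0 = 0, and its Γ₁-part to Σ_k (2b+1) · h k = 0
-- since 2a+1 divides 2b+1.
module Submission where

open import Defs
open import Level using (Level; _⊔_)
open import Algebra.Bundles using (AbelianGroup)
open import Algebra.Construct.DirectProduct using (abelianGroup)
open import Data.Nat using (ℕ; _+_; _*_)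
open import Data.Nat.Divisibility using (_∣_; divides)

open import Data.Nat.Base using (zero; suc)
import Data.Nat.Properties as ℕ
open import Data.Nat.Tactic.RingSolver using (solve-∀)
open import Data.Fin.Base using (Fin; zero; suc; _<_; splitAt; join; remQuot; quotRem)
open import Data.Fin.Properties using (_<?_)
import Data.Fin.Properties as Fin
open import Data.Fin.Permutation using (permutation)
open import Data.Product using (Σ; _×_; _,_; proj₁; proj₂; ∃; swap; map₁; map₂)
open import Data.Sum using (_⊎_; inj₁; inj₂; [_,_]′)
open import Data.Sum.Function.Propositional using (_⊎-↔_)
open import Data.List.Base using (List; _∷_; filter; length; lookup; allFin)
open import Data.List.Relation.Unary.Unique.Propositional using (Unique)
open import Data.List.Relation.Unary.AllPairs using (_∷_)
import Data.List.Relation.Unary.All as All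
import Data.List.Relation.Unary.Any as Any
open import Data.List.Relation.Unary.Any.Properties using (lookup-index)
import Data.List.Relation.Unary.Unique.Propositional.Properties as Unique
open import Data.List.Membership.Propositional using (_∈_)
open import Data.List.Membership.Propositional.Properties using (∈-lookup; ∈-filter⁺; ∈-filter⁻; ∈-allFin)
open import Data.Empty using (⊥-elim)
open import Function.Base using (_∘_)
open import Function.Bundles using (Bijection; Inverse; _↔_)
open import Function.Definitions using (Congruent)
open import Function.Properties.Bijection using (Bijection⇒Inverse)
open import Function.Properties.Inverse using (↔-trans; ↔-refl)
open import Relation.Binary.Definitions using (Decidable; tri<; tri≈; tri>)
open import Relation.Binary.PropositionalEquality as ≡ using (_≡_; _≢_)
open import Relation.Nullary using (¬_; yes; no)
import Algebra.Properties.AbelianGroup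

1+a*2≡2*a+1 : ∀ a → suc (a * 2) ≡ 2 * a + 1
1+a*2≡2*a+1 = solve-∀

1+n+n≡2*n+1 : ∀ n → suc (n + n) ≡ 2 * n + 1
1+n+n≡2*n+1 = solve-∀

1+m+m≡2*n+1⇒m≡n : ∀ {m n} → suc (m + m) ≡ 2 * n + 1 → m ≡ n
1+m+m≡2*n+1⇒m≡n {m} {n} eq =
  ℕ.*-cancelˡ-≡ m n 2 (ℕ.+-cancelʳ-≡ 1 (2 * m) (2 * n) (≡.trans (≡.sym (1+n+n≡2*n+1 m)) eq))

a+b+2ab≡a*[2b+1]+b : ∀ a b → a + b + 2 * a * b ≡ a * (2 * b + 1) + b
a+b+2ab≡a*[2b+1]+b = solve-∀

Unique⇒lookup-injective : ∀ {a} {A : Set a} {xs : List A} → Unique xs →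
                          ∀ {i j} → lookup xs i ≡ lookup xs j → i ≡ j
Unique⇒lookup-injective {xs = _ ∷ _} (_ ∷ _)     {zero}  {zero}  _  = ≡.refl
Unique⇒lookup-injective {xs = _ ∷ _} (x∉ ∷ _)    {zero}  {suc j} eq = ⊥-elim (All.lookup x∉ (∈-lookup j) eq)
Unique⇒lookup-injective {xs = _ ∷ _} (x∉ ∷ _)    {suc i} {zero}  eq = ⊥-elim (All.lookup x∉ (∈-lookup i) (≡.sym eq))
Unique⇒lookup-injective {xs = _ ∷ _} (_ ∷ uniq) {suc i} {suc j} eq = ≡.cong suc (Unique⇒lookup-injective uniq eq)

splitAt-injective : ∀ m {n} {s t : Fin (m + n)} → splitAt m s ≡ splitAt m t → s ≡ t
splitAt-injective m {n} {s} {t} eq = begin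
  s                       ≡⟨ Fin.join-splitAt m n s ⟨
  join m n (splitAt m s)  ≡⟨ ≡.cong (join m n) eq ⟩
  join m n (splitAt m t)  ≡⟨ Fin.join-splitAt m n t ⟩
  t                       ∎
  where open ≡.≡-Reasoning

*+↔×⊎ : ∀ a n b → Fin (a * n + b) ↔ ((Fin a × Fin n) ⊎ Fin b)
*+↔×⊎ a n b = ↔-trans Fin.+↔⊎ (Fin.*↔× ⊎-↔ ↔-refl)

module InvolutionTransversal {n} (σ : Fin n → Fin n) (σ-involutive : ∀ i → σ (σ i) ≡ i)
                             {i₀ : Fin n} (i₀-fixed : σ i₀ ≡ i₀) (fixed⇒i₀ : ∀ i → σ i ≡ i → i ≡ i₀) where

  leaders : List (Fin n)
  leaders = filter (λ i → i <? σ i) (allFin n)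

  m : ℕ
  m = length leaders

  rep : Fin m → Fin n
  rep = lookup leaders

  rep<σrep : ∀ k → rep k < σ (rep k)
  rep<σrep k = proj₂ (∈-filter⁻ (λ i → i <? σ i) {xs = allFin n} (∈-lookup k))

  rep-injective : ∀ {k k′} → rep k ≡ rep k′ → k ≡ k′
  rep-injective = Unique⇒lookup-injective (Unique.filter⁺ (λ i → i <? σ i) (Unique.allFin⁺ n))

  leader⇒rep : ∀ i → i < σ i → ∃ λ k → rep k ≡ i
  leader⇒rep i i<σi = Any.index i∈ , ≡.sym (lookup-index i∈)
    where
    i∈ : i ∈ leaders
    i∈ = ∈-filter⁺ (λ i → i <? σ i) (∈-allFin i) i<σi

  σ-injective : ∀ {i j} → σ i ≡ σ j → i ≡ j
  σ-injective {i} {j} eq = ≡.trans (≡.sym (σ-involutive i)) (≡.trans (≡.cong σ eq) (σ-involutive j))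

  rep≢σrep : ∀ k k′ → rep k ≢ σ (rep k′)
  rep≢σrep k k′ eq = Fin.<-asym (≡.subst (rep k <_) σrepk≡repk′ (rep<σrep k))
                                (≡.subst (rep k′ <_) (≡.sym eq) (rep<σrep k′))
    where
    σrepk≡repk′ : σ (rep k) ≡ rep k′
    σrepk≡repk′ = ≡.trans (≡.cong σ eq) (σ-involutive (rep k′))

  orbitElement : Fin m ⊎ Fin m → Fin n
  orbitElement = [ rep , σ ∘ rep ]′

  orbitElement-injective : ∀ {s t} → orbitElement s ≡ orbitElement t → s ≡ t
  orbitElement-injective {inj₁ k} {inj₁ k′} eq = ≡.cong inj₁ (rep-injective eq)
  orbitElement-injective {inj₁ k} {inj₂ k′} eq = ⊥-elim (rep≢σrep k k′ eq)
  orbitElement-injective {inj₂ k} {inj₁ k′} eq = ⊥-elim (rep≢σrep k′ k (≡.sym eq))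
  orbitElement-injective {inj₂ k} {inj₂ k′} eq = ≡.cong inj₂ (rep-injective (σ-injective eq))

  rep≢i₀ : ∀ k → rep k ≢ i₀
  rep≢i₀ k eq = Fin.<-irrefl (≡.sym (≡.trans (≡.cong σ eq) (≡.trans i₀-fixed (≡.sym eq)))) (rep<σrep k)

  orbitElement≢i₀ : ∀ s → orbitElement s ≢ i₀
  orbitElement≢i₀ (inj₁ k) = rep≢i₀ k
  orbitElement≢i₀ (inj₂ k) eq = rep≢i₀ k (≡.trans (≡.sym (σ-involutive _)) (≡.trans (≡.cong σ eq) i₀-fixed))

  orbitElement-surjective : ∀ i → i ≢ i₀ → ∃ λ s → orbitElement s ≡ i
  orbitElement-surjective i i≢i₀ with Fin.<-cmp i (σ i)
  ... | tri< i<σi _ _ = let k , repk≡i = leader⇒rep i i<σi in inj₁ k , repk≡i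
  ... | tri≈ _ i≡σi _ = ⊥-elim (i≢i₀ (fixed⇒i₀ i (≡.sym i≡σi)))
  ... | tri> _ _ σi<i = let k , repk≡σi = leader⇒rep (σ i) σi<σσi
                        in inj₂ k , ≡.trans (≡.cong σ repk≡σi) (σ-involutive i)
    where
    σi<σσi : σ i < σ (σ i)
    σi<σσi = ≡.subst (σ i <_) (≡.sym (σ-involutive i)) σi<i

  element : Fin (suc (m + m)) → Fin n
  element zero    = i₀
  element (suc t) = orbitElement (splitAt m t)

  element-injective : ∀ {s t} → element s ≡ element t → s ≡ t
  element-injective {zero}  {zero}  _  = ≡.refl
  element-injective {zero}  {suc t} eq = ⊥-elim (orbitElement≢i₀ (splitAt m t) (≡.sym eq))
  element-injective {suc s} {zero}  eq = ⊥-elim (orbitElement≢i₀ (splitAt m s) eq)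
  element-injective {suc s} {suc t} eq = ≡.cong suc (splitAt-injective m (orbitElement-injective eq))

  position : Fin n → Fin (suc (m + m))
  position i with i Fin.≟ i₀
  ... | yes _    = zero
  ... | no i≢i₀ = suc (join m m (proj₁ (orbitElement-surjective i i≢i₀)))

  element-position : ∀ i → element (position i) ≡ i
  element-position i with i Fin.≟ i₀
  ... | yes i≡i₀ = ≡.sym i≡i₀
  ... | no i≢i₀  = let s , eq = orbitElement-surjective i i≢i₀
                   in ≡.trans (≡.cong orbitElement (Fin.splitAt-join m m s)) eq

  size : suc (m + m) ≡ n
  size = ℕ.≤-antisym (Fin.injective⇒≤ element-injective) (Fin.injective⇒≤ position-injective)
    where
    position-injective : ∀ {i j} → position i ≡ position j → i ≡ j
    position-injective {i} {j} eq =
      ≡.trans (≡.sym (element-position i)) (≡.trans (≡.cong element eq) (element-position j))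

module AbelianGroupSums {c ℓ} (G : AbelianGroup c ℓ) where
  open AbelianGroup G
  open import Algebra.Properties.AbelianGroup G using (ε⁻¹≈ε; ⁻¹-∙-comm)
  open import Algebra.Properties.CommutativeMonoid.Sum commutativeMonoid public
    using (sum; sum-cong-≋; sum-replicate; sum-replicate-zero; sum-permute; ∑-distrib-+)
  open import Algebra.Properties.Monoid.Mult monoid public
    using (×-congʳ; ×-assocˡ) renaming (_×_ to _·_)

  sum-⊎ : ∀ m {n} (f : Fin m ⊎ Fin n → Carrier) →
          sum (f ∘ splitAt m) ≈ sum (f ∘ inj₁) ∙ sum (f ∘ inj₂)
  sum-⊎ zero    f = sym (identityˡ _)
  sum-⊎ (suc m) f = trans (∙-congˡ (sum-⊎ m (f ∘ Data.Sum.map₁ suc))) (sym (assoc _ _ _))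

  sum-× : ∀ m {n} (f : Fin m × Fin n → Carrier) →
          sum (f ∘ remQuot n) ≈ sum (λ k → sum (λ l → f (k , l)))
  sum-× zero        f = refl
  sum-× (suc m) {n} f =
    trans (sum-⊎ n (f ∘ swap ∘ [ (_, zero) , map₂ suc ∘ quotRem {m} n ]′))
          (∙-congˡ (sum-× m (f ∘ map₁ suc)))

  sum-*+↔×⊎ : ∀ a {n b} (f : (Fin a × Fin n) ⊎ Fin b → Carrier) →
              sum (f ∘ Inverse.to (*+↔×⊎ a n b)) ≈ sum (λ k → sum (λ l → f (inj₁ (k , l)))) ∙ sum (f ∘ inj₂)
  sum-*+↔×⊎ a {n} f = trans (sum-⊎ (a * n) (f ∘ Data.Sum.map₁ (remQuot n))) (∙-congʳ (sum-× a (f ∘ inj₁)))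

  sum-≈ε : ∀ {n} {f : Fin n → Carrier} → (∀ i → f i ≈ ε) → sum f ≈ ε
  sum-≈ε {n} f≈ε = trans (sum-cong-≋ f≈ε) (sum-replicate-zero n)

  sum-⁻¹ : ∀ {n} (f : Fin n → Carrier) → sum (λ i → f i ⁻¹) ≈ sum f ⁻¹
  sum-⁻¹ {zero}  f = sym ε⁻¹≈ε
  sum-⁻¹ {suc n} f = trans (∙-congˡ (sum-⁻¹ (f ∘ suc))) (⁻¹-∙-comm _ _)

  ×-ε : ∀ n → n · ε ≈ ε
  ×-ε n = trans (sym (sum-replicate n)) (sum-replicate-zero n)

  ×≈ε-∣ : ∀ {n m x} → n · x ≈ ε → n ∣ m → m · x ≈ ε
  ×≈ε-∣ {n} {x = x} n·x≈ε (divides q ≡.refl) =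
    trans (sym (×-assocˡ x q n)) (trans (×-congʳ q n·x≈ε) (×-ε q))

  x∙x≈ε⇒x≈ε : ∀ a {x} → (2 * a + 1) · x ≈ ε → x ∙ x ≈ ε → x ≈ ε
  x∙x≈ε⇒x≈ε a {x} [2a+1]x≈ε x∙x≈ε = begin
    x                   ≈⟨ identityʳ x ⟨
    x ∙ ε               ≈⟨ ∙-congˡ (×-ε a) ⟨
    x ∙ a · ε           ≈⟨ ∙-congˡ (×-congʳ a (trans (∙-congˡ (identityʳ x)) x∙x≈ε)) ⟨
    x ∙ a · (2 · x)     ≈⟨ ∙-congˡ (×-assocˡ x a 2) ⟩
    suc (a * 2) · x     ≡⟨ ≡.cong (_· x) (1+a*2≡2*a+1 a) ⟩
    (2 * a + 1) · x     ≈⟨ [2a+1]x≈ε ⟩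
    ε                   ∎
    where open import Relation.Binary.Reasoning.Setoid setoid

module FiniteAbelianGroup {c ℓ} (G : AbelianGroup c ℓ) {n} (ord : HasOrder G n) where
  open AbelianGroup G
  open AbelianGroupSums G
  open import Algebra.Properties.AbelianGroup G using (⁻¹-involutive; identityˡ-unique; \\-leftDividesˡ; \\-leftDividesʳ)
  open Inverse (Bijection⇒Inverse ord) public using (to; from; from-cong; strictlyInverseˡ; strictlyInverseʳ)
  open import Relation.Binary.Reasoning.Setoid setoid

  from-injective : ∀ {x y} → from x ≡ from y → x ≈ y
  from-injective {x} {y} eq = begin
    x             ≈⟨ strictlyInverseˡ x ⟨
    to (from x)   ≡⟨ ≡.cong to eq ⟩
    to (from y)   ≈⟨ strictlyInverseˡ y ⟩
    y             ∎

  _≟_ : Decidable _≈_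
  x ≟ y with from x Fin.≟ from y
  ... | yes eq = yes (from-injective eq)
  ... | no neq = no (neq ∘ from-cong)

  sum-elements-invariant : (φ ψ : Carrier → Carrier) → Congruent _≈_ _≈_ φ → Congruent _≈_ _≈_ ψ →
                           (∀ x → φ (ψ x) ≈ x) → (∀ x → ψ (φ x) ≈ x) → sum to ≈ sum (φ ∘ to)
  sum-elements-invariant φ ψ φ-cong ψ-cong φψ ψφ = begin
    sum to                                ≈⟨ sum-permute to (permutation (lift φ) (lift ψ) (lift-inverse φ-cong φψ) (lift-inverse ψ-cong ψφ)) ⟩
    sum (λ i → to (from (φ (to i))))      ≈⟨ sum-cong-≋ (λ i → strictlyInverseˡ (φ (to i))) ⟩
    sum (φ ∘ to)                          ∎
    where
    lift : (Carrier → Carrier) → Fin n → Fin n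
    lift f = from ∘ f ∘ to
    lift-inverse : ∀ {f g} → Congruent _≈_ _≈_ f → (∀ x → f (g x) ≈ x) → ∀ i → lift f (lift g i) ≡ i
    lift-inverse {f} {g} f-cong fg i =
      ≡.trans (from-cong (trans (f-cong (strictlyInverseˡ (g (to i)))) (fg (to i)))) (strictlyInverseʳ i)

  n·x≈ε : ∀ x → n · x ≈ ε
  n·x≈ε x = identityˡ-unique (n · x) (sum to) (sym (begin
    sum to                     ≈⟨ sum-elements-invariant (x ∙_) (x ⁻¹ ∙_) ∙-congˡ ∙-congˡ (\\-leftDividesˡ x) (\\-leftDividesʳ x) ⟩
    sum (λ i → x ∙ to i)       ≈⟨ ∑-distrib-+ (λ _ → x) to ⟩
    sum {n} (λ _ → x) ∙ sum to ≈⟨ ∙-congʳ (sum-replicate n) ⟩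
    n · x ∙ sum to             ∎))

  sum-elements-self-inverse : sum to ≈ sum to ⁻¹
  sum-elements-self-inverse = begin
    sum to                 ≈⟨ sum-elements-invariant _⁻¹ _⁻¹ ⁻¹-cong ⁻¹-cong ⁻¹-involutive ⁻¹-involutive ⟩
    sum (λ i → to i ⁻¹)    ≈⟨ sum-⁻¹ to ⟩
    sum to ⁻¹              ∎

record IsHalfSet {c ℓ i} (G : AbelianGroup c ℓ) {I : Set i} (h : I → AbelianGroup.Carrier G) : Set (c ⊔ ℓ ⊔ i) where
  open AbelianGroup G
  field
    injective    : ∀ {k k′} → h k ≈ h k′ → k ≡ k′
    no-opposites : ∀ k k′ → ¬ (h k ≈ h k′ ⁻¹)
    covers       : ∀ g → ¬ (g ≈ ε) → ∃ λ k → h k ≈ g ⊎ h k ⁻¹ ≈ g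

  nonzero : ∀ k → ¬ (h k ≈ ε)
  nonzero k hk≈ε = no-opposites k k (trans hk≈ε (sym (trans (⁻¹-cong hk≈ε) ε⁻¹≈ε)))
    where open Algebra.Properties.AbelianGroup G using (ε⁻¹≈ε)

module HalfSets {c ℓ} (G : AbelianGroup c ℓ) where
  open AbelianGroup G
  open AbelianGroupSums G using (sum; sum-⁻¹)
  open import Algebra.Properties.AbelianGroup G using (ε⁻¹≈ε; inverseʳ-unique; ⁻¹-injective)

  reindex : ∀ {i j} {I : Set i} {J : Set j} {h : I → Carrier} →
            IsHalfSet G h → (e : J ↔ I) → IsHalfSet G (h ∘ Inverse.to e)
  reindex {h = h} half e = record
    { injective    = λ {k} {k′} eq → ≡.trans (≡.sym (strictlyInverseʳ k))
                                       (≡.trans (≡.cong from (H.injective eq)) (strictlyInverseʳ k′))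
    ; no-opposites = λ k k′ → H.no-opposites (to k) (to k′)
    ; covers       = λ g g≉ε → let k , hk≈±g = H.covers g g≉ε in
                     from k , ≡.subst (λ k → h k ≈ g ⊎ h k ⁻¹ ≈ g) (≡.sym (strictlyInverseˡ k)) hk≈±g
    }
    where
    module H = IsHalfSet half
    open Inverse e

  rowAndNegation : ∀ {n} → (Fin n → Carrier) → Fin 2 → Fin n → Carrier
  rowAndNegation R zero    = R
  rowAndNegation R (suc _) = λ j → R j ⁻¹

  halfSet⇒M0Star : ∀ {n} {R : Fin n → Carrier} → IsHalfSet G R → sum R ≈ ε →
                   IsM0Star G n (rowAndNegation R)
  halfSet⇒M0Star {R = R} half ΣR≈ε = record
    { entries-nonzero  = nonzero
    ; entries-distinct = distinct
    ; covers-nonzero   = covers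
    ; row-sums         = λ { zero → ΣR≈ε ; (suc zero) → trans (sum-⁻¹ R) (trans (⁻¹-cong ΣR≈ε) ε⁻¹≈ε) }
    ; column-sums      = λ j → trans (∙-congˡ (identityʳ _)) (inverseʳ (R j))
    }
    where
    module H = IsHalfSet half
    nonzero : ∀ i j → ¬ (rowAndNegation R i j ≈ ε)
    nonzero zero       j       = H.nonzero j
    nonzero (suc zero) j Rj⁻¹≈ε = H.nonzero j (⁻¹-injective (trans Rj⁻¹≈ε (sym ε⁻¹≈ε)))
    distinct : ∀ i j i′ j′ → rowAndNegation R i j ≈ rowAndNegation R i′ j′ → (i ≡ i′) × (j ≡ j′)
    distinct zero       j zero       j′ eq = ≡.refl , H.injective eq
    distinct zero       j (suc zero) j′ eq = ⊥-elim (H.no-opposites j j′ eq)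
    distinct (suc zero) j zero       j′ eq = ⊥-elim (H.no-opposites j′ j (sym eq))
    distinct (suc zero) j (suc zero) j′ eq = ≡.refl , H.injective (⁻¹-injective eq)
    covers : ∀ g → ¬ (g ≈ ε) → ∃ λ i → ∃ λ j → rowAndNegation R i j ≈ g
    covers g g≉ε with H.covers g g≉ε
    ... | k , inj₁ Rk≈g   = zero , k , Rk≈g
    ... | k , inj₂ Rk⁻¹≈g = suc zero , k , Rk⁻¹≈g

  firstRow-isHalfSet : ∀ {n A} → IsM0Star G n A → IsHalfSet G (A zero)
  firstRow-isHalfSet {A = A} isM0 = record
    { injective    = λ eq → proj₂ (M.entries-distinct zero _ zero _ eq)
    ; no-opposites = λ j j′ eq →
        Fin.0≢1+n (proj₁ (M.entries-distinct zero j (suc zero) j′ (trans eq (sym (secondRow j′)))))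
    ; covers       = covers
    }
    where
    module M = IsM0Star isM0
    secondRow : ∀ j → A (suc zero) j ≈ A zero j ⁻¹
    secondRow j = inverseʳ-unique _ _ (trans (∙-congˡ (sym (identityʳ _))) (M.column-sums j))
    covers : ∀ g → ¬ (g ≈ ε) → ∃ λ j → A zero j ≈ g ⊎ A zero j ⁻¹ ≈ g
    covers g g≉ε with M.covers-nonzero g g≉ε
    ... | zero     , j , A₀j≈g = j , inj₁ A₀j≈g
    ... | suc zero , j , A₁j≈g = j , inj₂ (trans (sym (secondRow j)) A₁j≈g)

module OddOrder {c ℓ} (G : AbelianGroup c ℓ) (a : ℕ) (ord : HasOrder G (2 * a + 1)) where
  open AbelianGroup G
  open AbelianGroupSums G
  open FiniteAbelianGroup G ord
  open import Algebra.Properties.AbelianGroup G using (ε⁻¹≈ε; ⁻¹-involutive)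

  sum-elements≈ε : sum to ≈ ε
  sum-elements≈ε = x∙x≈ε⇒x≈ε a (n·x≈ε _) (trans (∙-congˡ sum-elements-self-inverse) (inverseʳ _))

  x≈x⁻¹⇒x≈ε : ∀ {x} → x ≈ x ⁻¹ → x ≈ ε
  x≈x⁻¹⇒x≈ε {x} x≈x⁻¹ = x∙x≈ε⇒x≈ε a (n·x≈ε x) (trans (∙-congˡ x≈x⁻¹) (inverseʳ x))

  negation : Fin (2 * a + 1) → Fin (2 * a + 1)
  negation i = from (to i ⁻¹)

  to-negation : ∀ i → to (negation i) ≈ to i ⁻¹
  to-negation i = strictlyInverseˡ (to i ⁻¹)

  negation-involutive : ∀ i → negation (negation i) ≡ i
  negation-involutive i =
    ≡.trans (from-cong (trans (⁻¹-cong (to-negation i)) (⁻¹-involutive (to i)))) (strictlyInverseʳ i)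

  negation-fixes-ε : negation (from ε) ≡ from ε
  negation-fixes-ε = from-cong (trans (⁻¹-cong (strictlyInverseˡ ε)) ε⁻¹≈ε)

  negation-fixed⇒ε : ∀ i → negation i ≡ i → i ≡ from ε
  negation-fixed⇒ε i fixed = ≡.trans (≡.sym (strictlyInverseʳ i))
    (from-cong (x≈x⁻¹⇒x≈ε (trans (reflexive (≡.cong to (≡.sym fixed))) (to-negation i))))

  open InvolutionTransversal negation negation-involutive negation-fixes-ε negation-fixed⇒ε

  halfSet : Σ (Fin a → Carrier) (IsHalfSet G)
  halfSet = ≡.subst (λ m → Σ (Fin m → Carrier) (IsHalfSet G)) (1+m+m≡2*n+1⇒m≡n size) (to ∘ rep , isHalfSet)
    where
    isHalfSet : IsHalfSet G (to ∘ rep)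
    isHalfSet = record
      { injective    = λ eq → rep-injective (≡.trans (≡.sym (strictlyInverseʳ _))
                                               (≡.trans (from-cong eq) (strictlyInverseʳ _)))
      ; no-opposites = λ k k′ eq → rep≢σrep k k′ (≡.trans (≡.sym (strictlyInverseʳ _)) (from-cong eq))
      ; covers       = covers
      }
      where
      covers : ∀ g → ¬ (g ≈ ε) → ∃ λ k → to (rep k) ≈ g ⊎ to (rep k) ⁻¹ ≈ g
      covers g g≉ε with orbitElement-surjective (from g) (g≉ε ∘ from-injective)
      ... | inj₁ k , repk≡g  = k , inj₁ (trans (reflexive (≡.cong to repk≡g)) (strictlyInverseˡ g))
      ... | inj₂ k , σrepk≡g = k , inj₂ (begin
            to (rep k) ⁻¹          ≈⟨ to-negation (rep k) ⟨
            to (negation (rep k))  ≡⟨ ≡.cong to σrepk≡g ⟩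
            to (from g)            ≈⟨ strictlyInverseˡ g ⟩
            g                      ∎)
        where open import Relation.Binary.Reasoning.Setoid setoid

module DirectSum {c₁ ℓ₁ c₂ ℓ₂} (Γ₁ : AbelianGroup c₁ ℓ₁) (Γ₂ : AbelianGroup c₂ ℓ₂) where
  Γ : AbelianGroup (c₁ ⊔ c₂) (ℓ₁ ⊔ ℓ₂)
  Γ = abelianGroup Γ₁ Γ₂
  private
    module Γ₁ = AbelianGroup Γ₁
    module Γ₂ = AbelianGroup Γ₂
    module Γ = AbelianGroup Γ
    module S₁ = AbelianGroupSums Γ₁
    module S₂ = AbelianGroupSums Γ₂
    module S = AbelianGroupSums Γ
    module P₁ = Algebra.Properties.AbelianGroup Γ₁
    module P₂ = Algebra.Properties.AbelianGroup Γ₂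

  sum-proj₁ : ∀ {n} (f : Fin n → Γ.Carrier) → proj₁ (S.sum f) ≡ S₁.sum (proj₁ ∘ f)
  sum-proj₁ {zero}  f = ≡.refl
  sum-proj₁ {suc n} f = ≡.cong (proj₁ (f zero) Γ₁.∙_) (sum-proj₁ (f ∘ suc))

  sum-proj₂ : ∀ {n} (f : Fin n → Γ.Carrier) → proj₂ (S.sum f) ≡ S₂.sum (proj₂ ∘ f)
  sum-proj₂ {zero}  f = ≡.refl
  sum-proj₂ {suc n} f = ≡.cong (proj₂ (f zero) Γ₂.∙_) (sum-proj₂ (f ∘ suc))

  productRow : ∀ {i k j} {I : Set i} {K : Set k} {J : Set j} →
               (I → Γ₁.Carrier) → (K → Γ₂.Carrier) → (J → Γ₂.Carrier) → (I × K) ⊎ J → Γ.Carrier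
  productRow h y e (inj₁ (k , l)) = h k , y l
  productRow h y e (inj₂ j)       = Γ₁.ε , e j

  productRow-isHalfSet : ∀ {i k j} {I : Set i} {K : Set k} {J : Set j} {h : I → Γ₁.Carrier} {e : J → Γ₂.Carrier} →
                         Decidable Γ₁._≈_ → IsHalfSet Γ₁ h → (enum : Bijection (≡.setoid K) Γ₂.setoid) → IsHalfSet Γ₂ e →
                         IsHalfSet Γ (productRow h (Bijection.to enum) e)
  productRow-isHalfSet {h = h} {e} _≟₁_ h-half enum e-half = record
    { injective    = injective
    ; no-opposites = no-opposites
    ; covers       = covers
    }
    where
    module H = IsHalfSet h-half
    module E = IsHalfSet e-half
    open Bijection enum using (to; strictlySurjective)
    R = productRow h to e

    injective : ∀ {d d′} → R d Γ.≈ R d′ → d ≡ d′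
    injective {inj₁ (k , l)} {inj₁ (k′ , l′)} (p , q) = ≡.cong₂ (λ k l → inj₁ (k , l)) (H.injective p) (Bijection.injective enum q)
    injective {inj₁ (k , _)} {inj₂ _}         (p , _) = ⊥-elim (H.nonzero k p)
    injective {inj₂ _}       {inj₁ (k′ , _)}  (p , _) = ⊥-elim (H.nonzero k′ (Γ₁.sym p))
    injective {inj₂ _}       {inj₂ _}         (_ , q) = ≡.cong inj₂ (E.injective q)

    no-opposites : ∀ d d′ → ¬ (R d Γ.≈ R d′ Γ.⁻¹)
    no-opposites (inj₁ (k , _)) (inj₁ (k′ , _)) (p , _) = H.no-opposites k k′ p
    no-opposites (inj₁ (k , _)) (inj₂ _)        (p , _) = H.nonzero k (Γ₁.trans p P₁.ε⁻¹≈ε)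
    no-opposites (inj₂ _)       (inj₁ (k′ , _)) (p , _) =
      H.nonzero k′ (P₁.⁻¹-injective (Γ₁.trans (Γ₁.sym p) (Γ₁.sym P₁.ε⁻¹≈ε)))
    no-opposites (inj₂ j)       (inj₂ j′)       (_ , q) = E.no-opposites j j′ q

    covers : ∀ g → ¬ (g Γ.≈ Γ.ε) → ∃ λ d → R d Γ.≈ g ⊎ R d Γ.⁻¹ Γ.≈ g
    covers (x , y) g≉ε with x ≟₁ Γ₁.ε
    ... | no x≉ε with H.covers x x≉ε
    ...   | k , inj₁ hk≈x   = let l , to[l]≈y = strictlySurjective y in
                              inj₁ (k , l) , inj₁ (hk≈x , to[l]≈y)
    ...   | k , inj₂ hk⁻¹≈x = let l , to[l]≈y⁻¹ = strictlySurjective (y Γ₂.⁻¹) in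
                              inj₁ (k , l) , inj₂ (hk⁻¹≈x , Γ₂.trans (Γ₂.⁻¹-cong to[l]≈y⁻¹) (P₂.⁻¹-involutive y))
    covers (x , y) g≉ε | yes x≈ε with E.covers y (λ y≈ε → g≉ε (x≈ε , y≈ε))
    ...   | j , inj₁ ej≈y   = inj₂ j , inj₁ (Γ₁.sym x≈ε , ej≈y)
    ...   | j , inj₂ ej⁻¹≈y = inj₂ j , inj₂ (Γ₁.trans P₁.ε⁻¹≈ε (Γ₁.sym x≈ε) , ej⁻¹≈y)

  productRow-sum : ∀ {a n b} (h : Fin a → Γ₁.Carrier) (y : Fin n → Γ₂.Carrier) (e : Fin b → Γ₂.Carrier) →
                   (∀ k → n S₁.· h k Γ₁.≈ Γ₁.ε) → S₂.sum y Γ₂.≈ Γ₂.ε → S₂.sum e Γ₂.≈ Γ₂.ε →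
                   S.sum (productRow h y e ∘ Inverse.to (*+↔×⊎ a n b)) Γ.≈ Γ.ε
  productRow-sum {a} {n} {b} h y e n·h≈ε Σy≈ε Σe≈ε = first , second
    where
    R = productRow h y e ∘ Inverse.to (*+↔×⊎ a n b)

    first : proj₁ (S.sum R) Γ₁.≈ Γ₁.ε
    first = begin
      proj₁ (S.sum R)                                                  ≡⟨ sum-proj₁ R ⟩
      S₁.sum (proj₁ ∘ R)                                               ≈⟨ S₁.sum-*+↔×⊎ a {n} {b} (proj₁ ∘ productRow h y e) ⟩
      S₁.sum (λ k → S₁.sum {n} (λ _ → h k)) Γ₁.∙ S₁.sum {b} (λ _ → Γ₁.ε) ≈⟨ Γ₁.∙-cong Σ[n·h]≈ε (S₁.sum-≈ε {b} (λ _ → Γ₁.refl)) ⟩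
      Γ₁.ε Γ₁.∙ Γ₁.ε                                                   ≈⟨ Γ₁.identityˡ Γ₁.ε ⟩
      Γ₁.ε                                                             ∎
      where
      open import Relation.Binary.Reasoning.Setoid Γ₁.setoid
      Σ[n·h]≈ε : S₁.sum (λ k → S₁.sum {n} (λ _ → h k)) Γ₁.≈ Γ₁.ε
      Σ[n·h]≈ε = S₁.sum-≈ε (λ k → Γ₁.trans (S₁.sum-replicate n) (n·h≈ε k))

    second : proj₂ (S.sum R) Γ₂.≈ Γ₂.ε
    second = begin
      proj₂ (S.sum R)                                         ≡⟨ sum-proj₂ R ⟩
      S₂.sum (proj₂ ∘ R)                                      ≈⟨ S₂.sum-*+↔×⊎ a {n} {b} (proj₂ ∘ productRow h y e) ⟩
      S₂.sum {a} (λ _ → S₂.sum y) Γ₂.∙ S₂.sum e                ≈⟨ Γ₂.∙-cong (S₂.sum-≈ε {a} (λ _ → Σy≈ε)) Σe≈ε ⟩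
      Γ₂.ε Γ₂.∙ Γ₂.ε                                          ≈⟨ Γ₂.identityˡ Γ₂.ε ⟩
      Γ₂.ε                                                    ∎
      where open import Relation.Binary.Reasoning.Setoid Γ₂.setoid

lemma5p7 : ∀ {c₁ ℓ₁ c₂ ℓ₂ : Level} (Γ₁ : AbelianGroup c₁ ℓ₁) (Γ₂ : AbelianGroup c₂ ℓ₂) (a b : ℕ) →
    HasOrder Γ₁ (2 * a + 1) → HasOrder Γ₂ (2 * b + 1) →
    (2 * a + 1) ∣ (2 * b + 1) →
    M0Star Γ₂ b →
    M0Star (abelianGroup Γ₁ Γ₂) (a + b + 2 * a * b)
lemma5p7 Γ₁ Γ₂ a b ord₁ ord₂ n₁∣n₂ (A , isM0) =
  ≡.subst (M0Star Γ) (≡.sym (a+b+2ab≡a*[2b+1]+b a b))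
          (rowAndNegation R , halfSet⇒M0Star R-isHalfSet R-sum)
  where
  open DirectSum Γ₁ Γ₂
  open HalfSets Γ
  open AbelianGroup Γ using (Carrier; _≈_; ε)
  open FiniteAbelianGroup Γ₁ ord₁ using (_≟_; n·x≈ε)
  open Σ (OddOrder.halfSet Γ₁ a ord₁) renaming (proj₁ to h; proj₂ to h-isHalfSet)

  R : Fin (a * (2 * b + 1) + b) → Carrier
  R = productRow h (Bijection.to ord₂) (A zero) ∘ Inverse.to (*+↔×⊎ a (2 * b + 1) b)

  R-isHalfSet : IsHalfSet Γ R
  R-isHalfSet = reindex (productRow-isHalfSet _≟_ h-isHalfSet ord₂ (HalfSets.firstRow-isHalfSet Γ₂ isM0))
                        (*+↔×⊎ a (2 * b + 1) b)

  R-sum : AbelianGroupSums.sum Γ R ≈ ε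
  R-sum = productRow-sum h (Bijection.to ord₂) (A zero)
            (λ k → AbelianGroupSums.×≈ε-∣ Γ₁ (n·x≈ε (h k)) n₁∣n₂)
            (OddOrder.sum-elements≈ε Γ₂ b ord₂)
            (IsM0Star.row-sums isM0 zero)
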